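{- For every $n\ge3$, $\mathrm{bet}(n)\ge\log_2(n-1)+1$.
   Context: An ordering of $[n]$ is a bijection $\phi:[n]\to[n]$. A ternary constraint is a triple $(x_1,x_2,x_3)$ of distinct elements of $[n]$. $\phi$ between-satisfies the constraint if $\phi(x_1)<\phi(x_2)<\phi(x_3)$ or $\phi(x_3)<\phi(x_2)<\phi(x_1)$. $\mathrm{bet}(n)$ is the minimum size of a set of orderings of $[n]$ such that every ternary constraint is between-satisfied by some ordering in the set. -}

module Defs where

open import Data.Nat using (ℕ; _≤_)
open import Data.Fin using (Fin; _<_)
open import Data.Fin.Permutation using (Permutation′)
open import Function.Bundles using (Inverse)
open import Data.Product using (Σ; _×_; _,_)
open import Data.Sum using (_⊎_)
open import Relation.Nullary using (¬_)
open import Relation.Binary.PropositionalEquality using (_≡_)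

Ordering : ℕ → Set
Ordering n = Permutation′ n

_⟪_⟫ : ∀ {n} → Ordering n → Fin n → Fin n
φ ⟪ x ⟫ = Inverse.to φ x

Distinct3 : ∀ {n} → Fin n → Fin n → Fin n → Set
Distinct3 x₁ x₂ x₃ = ¬ (x₁ ≡ x₂) × ¬ (x₁ ≡ x₃) × ¬ (x₂ ≡ x₃)

BetweenSat : ∀ {n} → Ordering n → Fin n → Fin n → Fin n → Set
BetweenSat φ x₁ x₂ x₃ =
  ((φ ⟪ x₁ ⟫ < φ ⟪ x₂ ⟫) × (φ ⟪ x₂ ⟫ < φ ⟪ x₃ ⟫))
  ⊎ ((φ ⟪ x₃ ⟫ < φ ⟪ x₂ ⟫) × (φ ⟪ x₂ ⟫ < φ ⟪ x₁ ⟫))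

BetweenCover : (n k : ℕ) → (Fin k → Ordering n) → Set
BetweenCover n k Φ =
  (x₁ x₂ x₃ : Fin n) → Distinct3 x₁ x₂ x₃ →
  Σ (Fin k) (λ i → BetweenSat (Φ i) x₁ x₂ x₃)

IsBet : ℕ → ℕ → Set
IsBet n b =
  Σ (Fin b → Ordering n) (BetweenCover n b)
  × ((k : ℕ) (Φ : Fin k → Ordering n) → BetweenCover n k Φ → b ≤ k)

module Submission where

-- Let Φ₁ … Φ_k be orderings of [n] that between-satisfy every ternary
-- constraint, and fix a pivot x.  For y ≠ x record the sign vector
-- σ(y) ∈ Bool^k whose i-th entry says whether y precedes x in Φᵢ.
--   * The constraint (y, x, z) forces some Φᵢ to put y and z on opposite
--     sides of x, so σ(y) ≠ σ(z) whenever y ≠ z.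
--   * The constraint (x, y, z) forces some Φᵢ to put y and z on the same
--     side of x, so σ(y) is never the complement of σ(z).
-- Hence the 2(n−1) vectors σ(y) and ¬σ(y) are pairwise distinct elements
-- of Bool^k, and 2(n−1) ≤ 2^k.

open import Defs
open import Data.Nat using (ℕ; _≤_; _*_; _∸_; _^_; _+_; suc; s≤s)
open import Data.Nat.Properties using (+-identityʳ)
open import Data.Fin using (Fin; _<_; _<?_; _≟_; splitAt; join; punchIn; funToFin; finToFun)
open import Data.Fin.Patterns using (0F; 1F; 2F)
open import Data.Fin.Properties
  using (2↔Bool; join-splitAt; injective⇒≤; finToFun-funToFin; <-trans; <-asym;
         punchInᵢ≢i; punchIn-injective)
open import Data.Bool using (Bool; true; false; not)
open import Data.Bool.Properties using (not-injective; not-¬)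
open import Data.Sum using (_⊎_; inj₁; inj₂)
open import Data.Product using (_,_; proj₁)
open import Function using (_∘_)
open import Function.Bundles using (Inverse)
open import Relation.Nullary using (¬_; does; yes; no)
open import Relation.Nullary.Decidable using (dec-true; dec-false; decidable-stable)
open import Relation.Binary.PropositionalEquality
  using (_≡_; _≢_; _≗_; refl; sym; trans; cong; subst)

encode : ∀ {k} → (Fin k → Bool) → Fin (2 ^ k)
encode f = funToFin (Inverse.from 2↔Bool ∘ f)

encode-injective : ∀ {k} {f g : Fin k → Bool} → encode f ≡ encode g → f ≗ g
encode-injective {f = f} {g} eq i =
  trans (sym (Inverse.strictlyInverseˡ 2↔Bool (f i)))
    (trans (cong (Inverse.to 2↔Bool) bits-agree)
      (Inverse.strictlyInverseˡ 2↔Bool (g i)))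
  where
  bits-agree : Inverse.from 2↔Bool (f i) ≡ Inverse.from 2↔Bool (g i)
  bits-agree =
    trans (sym (finToFun-funToFin (Inverse.from 2↔Bool ∘ f) i))
      (trans (cong (λ c → finToFun c i) eq)
        (finToFun-funToFin (Inverse.from 2↔Bool ∘ g) i))

code-bound : ∀ {a b k} (code : Fin a ⊎ Fin b → Fin k → Bool) →
             (∀ u v → code u ≗ code v → u ≡ v) → a + b ≤ 2 ^ k
code-bound {a} {b} code code-injective =
  injective⇒≤ {f = encode ∘ code ∘ splitAt a} λ {s} {t} eq →
    trans (sym (join-splitAt a b s))
      (trans (cong (join a b) (code-injective _ _ (encode-injective eq)))
        (join-splitAt a b t))

side : ∀ {n} → Ordering n → Fin n → Fin n → Bool
side φ x y = does (φ ⟪ y ⟫ <? φ ⟪ x ⟫)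

side-before : ∀ {n} (φ : Ordering n) {x y} → φ ⟪ y ⟫ < φ ⟪ x ⟫ →
              side φ x y ≡ true
side-before φ {x} {y} = dec-true (φ ⟪ y ⟫ <? φ ⟪ x ⟫)

side-after : ∀ {n} (φ : Ordering n) {x y} → φ ⟪ x ⟫ < φ ⟪ y ⟫ →
             side φ x y ≡ false
side-after φ {x} {y} x<y = dec-false (φ ⟪ y ⟫ <? φ ⟪ x ⟫) (<-asym x<y)

pivot-between : ∀ {n} (φ : Ordering n) {x y z} → BetweenSat φ y x z →
                side φ x y ≡ not (side φ x z)
pivot-between φ (inj₁ (y<x , x<z)) =
  trans (side-before φ y<x) (sym (cong not (side-after φ x<z)))
pivot-between φ (inj₂ (z<x , x<y)) =
  trans (side-after φ x<y) (sym (cong not (side-before φ z<x)))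

pivot-outside : ∀ {n} (φ : Ordering n) {x y z} → BetweenSat φ x y z →
                side φ x y ≡ side φ x z
pivot-outside φ (inj₁ (x<y , y<z)) =
  trans (side-after φ x<y) (sym (side-after φ (<-trans x<y y<z)))
pivot-outside φ (inj₂ (z<y , y<x)) =
  trans (side-before φ y<x) (sym (side-before φ (<-trans z<y y<x)))

-- The signature argument for a covering family of k ≥ 1 orderings of
-- [m + 1] and a pivot x; the other elements are punchIn x y for y : Fin m.
module PivotSignatures {m k} (Φ : Fin k → Ordering (suc m))
                       (cover : BetweenCover (suc m) k Φ)
                       (x : Fin (suc m)) (some-ordering : Fin k) where

  signature : Fin m → Fin k → Bool
  signature y i = side (Φ i) x (punchIn x y)

  punchIn-≢ : ∀ {y z} → y ≢ z → punchIn x y ≢ punchIn x z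
  punchIn-≢ {y} {z} y≢z = y≢z ∘ punchIn-injective x y z

  -- Distinct elements have distinct signatures (use the constraint (y, x, z)).
  signature-injective : ∀ y z → signature y ≗ signature z → y ≡ z
  signature-injective y z same = decidable-stable (y ≟ z) λ y≢z →
    let distinct = punchInᵢ≢i x y , punchIn-≢ y≢z , punchInᵢ≢i x z ∘ sym
        (i , sat) = cover (punchIn x y) x (punchIn x z) distinct
    in not-¬ (same i) (pivot-between (Φ i) sat)

  -- No signature is the complement of another (use the constraint (x, y, z);
  -- for y = z, a vector of positive length differs from its complement).
  no-antipodes : ∀ y z → ¬ (signature y ≗ not ∘ signature z)
  no-antipodes y z opposite with y ≟ z
  ... | yes refl = not-¬ refl (opposite some-ordering)
  ... | no y≢z =
    let distinct = punchInᵢ≢i x y ∘ sym , punchInᵢ≢i x z ∘ sym , punchIn-≢ y≢z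
        (i , sat) = cover x (punchIn x y) (punchIn x z) distinct
    in not-¬ (pivot-outside (Φ i) sat) (opposite i)

  code : Fin m ⊎ Fin m → Fin k → Bool
  code (inj₁ y) = signature y
  code (inj₂ y) = not ∘ signature y

  code-injective : ∀ u v → code u ≗ code v → u ≡ v
  code-injective (inj₁ y) (inj₁ z) same = cong inj₁ (signature-injective y z same)
  code-injective (inj₂ y) (inj₂ z) same =
    cong inj₂ (signature-injective y z (not-injective ∘ same))
  code-injective (inj₁ y) (inj₂ z) same with () ← no-antipodes y z same
  code-injective (inj₂ y) (inj₁ z) same with () ← no-antipodes z y (sym ∘ same)

  -- The main bound; 2 * m unfolds to m + (m + 0).
  bound : 2 * m ≤ 2 ^ k
  bound = subst (_≤ 2 ^ k) (cong (m +_) (sym (+-identityʳ m)))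
            (code-bound code code-injective)

-- Since bet(n) orderings cover every constraint, 2(n−1) ≤ 2^bet(n); a
-- first ordering exists because [n] with n ≥ 3 has a ternary constraint.
lemma3p1 : (n b : ℕ) → 3 ≤ n → IsBet n b → 2 * (n ∸ 1) ≤ 2 ^ b
lemma3p1 (suc (suc (suc p))) b (s≤s (s≤s (s≤s _))) ((Φ , cover) , _) =
  PivotSignatures.bound Φ cover 0F some-ordering
  where
  some-ordering : Fin b
  some-ordering = proj₁ (cover 0F 1F 2F ((λ ()) , (λ ()) , (λ ())))
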